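{- If $\mathbf{A}$ is a linear quasigroup, then either $s_n(\mathbf{A})\ge 2^{n-2}$ for all $n\in\mathbb{N}_+$, or $s_n(\mathbf{A})=1$ for all $n\in\mathbb{N}_+$.
   Context: A bracketing of size $n$ is a groupoid term obtained from $x_1x_2\cdots x_n$ by inserting parentheses to form a fully parenthesised binary product; $B_n$ is the set of them. For a groupoid $\mathbf{A}$, $s_n(\mathbf{A})$ is the number of distinct term operations on $\mathbf{A}$ induced by the bracketings in $B_n$ (the associative spectrum). A linear quasigroup is a groupoid $(A,\circ)$ with $x\circ y=\varphi_0(x)+\varphi_1(y)$ for some (not necessarily abelian) group $(A,+)$ and automorphisms $\varphi_0,\varphi_1$ of $(A,+)$. -}

module Defs where

open import Level using (Level; _⊔_)
open import Data.Nat using (ℕ; zero; suc; _+_; _∸_; _^_)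
open import Data.Fin using (Fin)
open import Data.Vec using (Vec; []; _∷_; take; drop)
open import Data.Product using (Σ; _×_; _,_)
open import Relation.Binary.PropositionalEquality using (_≡_; _≢_)
open import Relation.Nullary using (¬_)
open import Algebra.Bundles using (Group)
open import Algebra.Morphism.Structures using (module GroupMorphisms)

data Bracketing : ℕ → Set where
  leaf : Bracketing 1
  node : ∀ {m k} → Bracketing (suc m) → Bracketing (suc k) → Bracketing (suc m + suc k)

termOp : ∀ {a} {A : Set a} → (A → A → A) → ∀ {n} → Bracketing n → Vec A n → A
termOp _∘_ leaf (x ∷ []) = x
termOp _∘_ (node {m} {k} l r) xs =
  termOp _∘_ l (take (suc m) xs) ∘ termOp _∘_ r (drop (suc m) xs)

module _ {a ℓ} {A : Set a} (_≈_ : A → A → Set ℓ) (_∘_ : A → A → A) where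

  SameOp : ∀ {n} → Bracketing n → Bracketing n → Set (a ⊔ ℓ)
  SameOp t u = ∀ xs → termOp _∘_ t xs ≈ termOp _∘_ u xs

  -- s_n(A) ≥ k : there are k bracketings of size n inducing pairwise
  -- distinct term operations
  SpecAtLeast : ℕ → ℕ → Set (a ⊔ ℓ)
  SpecAtLeast n k = Σ (Fin k → Bracketing n) λ f →
    ∀ i j → i ≢ j → ¬ SameOp (f i) (f j)

  -- s_n(A) = 1 : all bracketings of size n induce the same term operation
  -- (B_n is nonempty for n ≥ 1)
  SpecIsOne : ℕ → Set (a ⊔ ℓ)
  SpecIsOne n = ∀ (t u : Bracketing n) → SameOp t u

IsAutomorphism : ∀ {c ℓ} (G : Group c ℓ) → (Group.Carrier G → Group.Carrier G) → Set (c ⊔ ℓ)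
IsAutomorphism G φ = GroupMorphisms.IsGroupIsomorphism (Group.rawGroup G) (Group.rawGroup G) φ

linOp : ∀ {c ℓ} (G : Group c ℓ) → (Group.Carrier G → Group.Carrier G) →
        (Group.Carrier G → Group.Carrier G) →
        Group.Carrier G → Group.Carrier G → Group.Carrier G
linOp G φ₀ φ₁ x y = Group._∙_ G (φ₀ x) (φ₁ y)

-- A bracketing t of x₁ ⋯ xₙ acts on a linear quasigroup as
-- x ↦ ψ₁(x₁) + ⋯ + ψₙ(xₙ), where ψⱼ composes φ₀ (left step) and φ₁ (right step)
-- along the path from the root of t to its j-th leaf; feeding inputs that are 0
-- in all but one place shows that bracketings with the same term operation have
-- the same ψⱼ for every j. If φ₀ = φ₁ = id, every bracketing yields x₁ + ⋯ + xₙ.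
-- If φ₀ ≠ id, consider the 2ⁿ⁻² bracketings C₁(C₂(⋯(C_k xₙ))) where the Cᵢ are
-- right combs whose sizes form a composition of n − 1: for two different
-- compositions, the last leaf of the first block where they disagree has path w
-- in one of them and w·left in the other, so equal term operations would force
-- φ₀ = id by injectivity. If φ₁ ≠ id, the mirror images of these bracketings
-- work in the same way.
module Submission where

open import Defs
open import Level using (Level; _⊔_)
open import Data.Nat using (ℕ; zero; suc; _+_; _∸_; _^_)
open import Data.Sum using (_⊎_; inj₁; inj₂)
open import Relation.Nullary using (¬_)
open import Algebra.Bundles using (Group; Monoid)

open import Algebra.Morphism.Structures using (module MonoidMorphisms; module GroupMorphisms)
open import Data.Empty using (⊥-elim)
open import Data.Fin using (Fin; zero; quotient; remainder; combine)
open import Data.Fin.Patterns using (0F; 1F)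
open import Data.Fin.Properties using (combine-remQuot)
open import Data.List using (List; []; _∷_; _++_; _∷ʳ_; map; reverse; length; foldr)
open import Data.List.Properties using (map-++; map-∘; length-map; length-++; reverse-++; reverse-map; reverse-involutive)
open import Data.List.Relation.Binary.Pointwise using (Pointwise; []; _∷_; reverse⁺; map⁻)
open import Data.Nat.Properties using (+-comm; suc-injective)
open import Data.Product using (∃₂; _×_; _,_)
import Data.Sum as Sum
open import Data.Vec using (Vec; []; _∷_; toList; take; drop; replicate)
open import Data.Vec.Properties using (∷-injectiveˡ; ∷-injectiveʳ; take++drop≡id; toList-++; length-toList)
open import Function using (_∘_)
open import Function.Definitions using (Injective)
open import Relation.Binary.PropositionalEquality using (_≡_; _≢_; refl; sym; trans; cong; cong₂; subst; subst₂; module ≡-Reasoning)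
import Relation.Binary.Reasoning.Setoid as SetoidReasoning

data Side : Set where
  left right : Side

opposite : Side → Side
opposite left  = right
opposite right = left

Path : Set
Path = List Side

mirrorPath : Path → Path
mirrorPath = map opposite

paths : ∀ {n} → Bracketing n → List Path
paths leaf       = [] ∷ []
paths (node l r) = map (left ∷_) (paths l) ++ map (right ∷_) (paths r)

length-paths : ∀ {n} (t : Bracketing n) → length (paths t) ≡ n
length-paths leaf = refl
length-paths (node l r) = begin
  length (map (left ∷_) (paths l) ++ map (right ∷_) (paths r))
    ≡⟨ length-++ (map (left ∷_) (paths l)) ⟩
  length (map (left ∷_) (paths l)) + length (map (right ∷_) (paths r))
    ≡⟨ cong₂ _+_ (trans (length-map _ (paths l)) (length-paths l))
                 (trans (length-map _ (paths r)) (length-paths r)) ⟩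
  _ ∎
  where open ≡-Reasoning

paths-subst : ∀ {m n} (e : m ≡ n) (t : Bracketing m) → paths (subst Bracketing e t) ≡ paths t
paths-subst refl t = refl

mirror : ∀ {n} → Bracketing n → Bracketing n
mirror leaf                = leaf
mirror (node {m} {k} l r) = subst Bracketing (+-comm (suc k) (suc m)) (node (mirror r) (mirror l))

mirrorPath-cons : ∀ s (ws : List Path) → map mirrorPath (map (s ∷_) ws) ≡ map (opposite s ∷_) (map mirrorPath ws)
mirrorPath-cons s ws = trans (sym (map-∘ ws)) (map-∘ ws)

paths-mirror : ∀ {n} (t : Bracketing n) → paths (mirror t) ≡ reverse (map mirrorPath (paths t))
paths-mirror leaf = refl
paths-mirror (node {m} {k} l r) = begin
  paths (mirror (node l r))
    ≡⟨ paths-subst (+-comm (suc k) (suc m)) (node (mirror r) (mirror l)) ⟩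
  map (left ∷_) (paths (mirror r)) ++ map (right ∷_) (paths (mirror l))
    ≡⟨ cong₂ (λ u v → map (left ∷_) u ++ map (right ∷_) v) (paths-mirror r) (paths-mirror l) ⟩
  map (left ∷_) (reverse (map mirrorPath (paths r))) ++ map (right ∷_) (reverse (map mirrorPath (paths l)))
    ≡⟨ cong₂ _++_ (reverse-map (left ∷_) (map mirrorPath (paths r))) (reverse-map (right ∷_) (map mirrorPath (paths l))) ⟩
  reverse (map (left ∷_) (map mirrorPath (paths r))) ++ reverse (map (right ∷_) (map mirrorPath (paths l)))
    ≡⟨ sym (reverse-++ (map (right ∷_) (map mirrorPath (paths l))) _) ⟩
  reverse (map (right ∷_) (map mirrorPath (paths l)) ++ map (left ∷_) (map mirrorPath (paths r)))
    ≡⟨ cong reverse (sym (cong₂ _++_ (mirrorPath-cons left (paths l)) (mirrorPath-cons right (paths r)))) ⟩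
  reverse (map mirrorPath (map (left ∷_) (paths l)) ++ map mirrorPath (map (right ∷_) (paths r)))
    ≡⟨ cong reverse (sym (map-++ mirrorPath (map (left ∷_) (paths l)) _)) ⟩
  reverse (map mirrorPath (paths (node l r))) ∎
  where open ≡-Reasoning

newBlock : ∀ {n} → Bracketing (suc n) → Bracketing (suc (suc n))
newBlock = node leaf

extendFirstBlock : ∀ {n} → Bracketing n → Bracketing (suc n)
extendFirstBlock leaf       = node leaf leaf
extendFirstBlock (node l r) = node (node leaf l) r

rightCombChain : ∀ {n} → Vec (Fin 2) n → Bracketing (suc (suc n))
rightCombChain []        = node leaf leaf
rightCombChain (0F ∷ bs) = newBlock (rightCombChain bs)
rightCombChain (1F ∷ bs) = extendFirstBlock (rightCombChain bs)

data IsNode : ∀ {n} → Bracketing n → Set where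
  is-node : ∀ {m k} {l : Bracketing (suc m)} {r : Bracketing (suc k)} → IsNode (node l r)

rightCombChain-isNode : ∀ {n} (bs : Vec (Fin 2) n) → IsNode (rightCombChain bs)
rightCombChain-isNode []        = is-node
rightCombChain-isNode (0F ∷ bs) = is-node
rightCombChain-isNode (1F ∷ bs) = extendFirstBlock-isNode (rightCombChain bs)
  where
  extendFirstBlock-isNode : ∀ {n} (t : Bracketing n) → IsNode (extendFirstBlock t)
  extendFirstBlock-isNode leaf       = is-node
  extendFirstBlock-isNode (node l r) = is-node

twist : Path → Path
twist (left ∷ w) = left ∷ right ∷ w
twist w          = w

paths-extendFirstBlock : ∀ {n} {t : Bracketing n} → IsNode t →
  paths (extendFirstBlock t) ≡ (left ∷ left ∷ []) ∷ map twist (paths t)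
paths-extendFirstBlock {t = node l r} is-node = cong ((left ∷ left ∷ []) ∷_) (begin
  map (left ∷_) (map (right ∷_) (paths l)) ++ map (right ∷_) (paths r)
    ≡⟨ cong₂ _++_ (trans (sym (map-∘ (paths l))) (map-∘ (paths l))) (map-∘ (paths r)) ⟩
  map twist (map (left ∷_) (paths l)) ++ map twist (map (right ∷_) (paths r))
    ≡⟨ sym (map-++ twist (map (left ∷_) (paths l)) _) ⟩
  map twist (paths (node l r)) ∎)
  where open ≡-Reasoning

-- Both paths are nonempty so that twist, which rewrites only the first step,
-- preserves the relation.
data Extends (c : Side) : Path → Path → Set where
  extends : ∀ b p → Extends c (b ∷ p ∷ʳ c) (b ∷ p)

Differ : Side → Path → Path → Set
Differ c x y = Extends c x y ⊎ Extends c y x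

extends-cons : ∀ {c x y} d → Extends c x y → Extends c (d ∷ x) (d ∷ y)
extends-cons d (extends b p) = extends d (b ∷ p)

extends-twist : ∀ {c x y} → Extends c x y → Extends c (twist x) (twist y)
extends-twist (extends left p)  = extends left (right ∷ p)
extends-twist (extends right p) = extends right p

extends-mirror : ∀ {c x y} → Extends c x y → Extends (opposite c) (mirrorPath x) (mirrorPath y)
extends-mirror {c} (extends b p) rewrite map-++ opposite p (c ∷ []) = extends (opposite b) (mirrorPath p)

differ-map : ∀ {c c' x y} {f : Path → Path} → (∀ {u v} → Extends c u v → Extends c' (f u) (f v)) →
             Differ c x y → Differ c' (f x) (f y)
differ-map h = Sum.map h h

data Somewhere {A : Set} (R : A → A → Set) : List A → List A → Set where
  here  : ∀ {x y xs ys} → R x y → Somewhere R (x ∷ xs) (y ∷ ys)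
  there : ∀ {x y xs ys} → Somewhere R xs ys → Somewhere R (x ∷ xs) (y ∷ ys)

somewhere-map : ∀ {A : Set} {R : A → A → Set} {xs ys} (f : A → A) →
                (∀ {x y} → R x y → R (f x) (f y)) → Somewhere R xs ys → Somewhere R (map f xs) (map f ys)
somewhere-map f h (here r)   = here (h r)
somewhere-map f h (there rs) = there (somewhere-map f h rs)

pointwise-somewhere : ∀ {p} {A : Set} {P : A → A → Set p} {R : A → A → Set} {xs ys} →
                      Pointwise P xs ys → Somewhere R xs ys → ∃₂ λ x y → P x y × R x y
pointwise-somewhere (p ∷ ps) (here r)   = _ , _ , p , r
pointwise-somewhere (p ∷ ps) (there rs) = pointwise-somewhere ps rs

pointwise-reverse⁻ : ∀ {p} {A : Set} {P : A → A → Set p} {xs ys : List A} →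
                     Pointwise P (reverse xs) (reverse ys) → Pointwise P xs ys
pointwise-reverse⁻ {P = P} {xs} {ys} ps =
  subst₂ (Pointwise P) (reverse-involutive xs) (reverse-involutive ys) (reverse⁺ ps)

rightCombChain-separated : ∀ {n} {bs bs' : Vec (Fin 2) n} → bs ≢ bs' →
  Somewhere (Differ left) (paths (rightCombChain bs)) (paths (rightCombChain bs'))
rightCombChain-separated {bs = []} {[]} bs≢bs' = ⊥-elim (bs≢bs' refl)
rightCombChain-separated {bs = 0F ∷ bs} {0F ∷ bs'} bs≢bs' =
  there (somewhere-map (right ∷_) (differ-map (extends-cons right))
          (rightCombChain-separated (bs≢bs' ∘ cong (0F ∷_))))
rightCombChain-separated {bs = 1F ∷ bs} {1F ∷ bs'} bs≢bs'
  rewrite paths-extendFirstBlock (rightCombChain-isNode bs)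
        | paths-extendFirstBlock (rightCombChain-isNode bs') =
  there (somewhere-map twist (differ-map extends-twist)
          (rightCombChain-separated (bs≢bs' ∘ cong (1F ∷_))))
rightCombChain-separated {bs = 0F ∷ bs} {1F ∷ bs'} _
  rewrite paths-extendFirstBlock (rightCombChain-isNode bs') = here (inj₂ (extends left []))
rightCombChain-separated {bs = 1F ∷ bs} {0F ∷ bs'} _
  rewrite paths-extendFirstBlock (rightCombChain-isNode bs) = here (inj₁ (extends left []))

digits : ∀ n → Fin (2 ^ n) → Vec (Fin 2) n
digits zero    _ = []
digits (suc n) i = quotient {2} (2 ^ n) i ∷ digits n (remainder {2} (2 ^ n) i)

digits-injective : ∀ n {i j} → digits n i ≡ digits n j → i ≡ j
digits-injective zero    {zero} {zero} _ = refl
digits-injective (suc n) {i} {j} e = begin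
  i                                                        ≡⟨ sym (combine-remQuot {2} (2 ^ n) i) ⟩
  combine (quotient {2} (2 ^ n) i) (remainder {2} (2 ^ n) i) ≡⟨ cong₂ combine (∷-injectiveˡ e) (digits-injective n (∷-injectiveʳ e)) ⟩
  combine (quotient {2} (2 ^ n) j) (remainder {2} (2 ^ n) j) ≡⟨ combine-remQuot {2} (2 ^ n) j ⟩
  j                                                        ∎
  where open ≡-Reasoning

specAtLeast-digits : ∀ {a ℓ} {A : Set a} (_≈_ : A → A → Set ℓ) (_∙_ : A → A → A) {m} n
  (f : Vec (Fin 2) n → Bracketing m) →
  (∀ {bs bs'} → bs ≢ bs' → ¬ SameOp _≈_ _∙_ (f bs) (f bs')) → SpecAtLeast _≈_ _∙_ m (2 ^ n)
specAtLeast-digits _≈_ _∙_ n f distinct = f ∘ digits n , λ i j i≢j → distinct (i≢j ∘ digits-injective n)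

chainFamily : Side → ∀ {n} → Vec (Fin 2) n → Bracketing (suc (suc n))
chainFamily left  = rightCombChain
chainFamily right = mirror ∘ rightCombChain

module LinearTermOperations {c ℓ} (M : Monoid c ℓ) (φ₀ φ₁ : Monoid.Carrier M → Monoid.Carrier M)
  (hom₀ : MonoidMorphisms.IsMonoidHomomorphism (Monoid.rawMonoid M) (Monoid.rawMonoid M) φ₀)
  (hom₁ : MonoidMorphisms.IsMonoidHomomorphism (Monoid.rawMonoid M) (Monoid.rawMonoid M) φ₁) where

  open Monoid M renaming (refl to ≈-refl; sym to ≈-sym; trans to ≈-trans)
  open MonoidMorphisms rawMonoid rawMonoid using (IsMonoidHomomorphism)
  open SetoidReasoning setoid

  φ : Side → Carrier → Carrier
  φ left  = φ₀
  φ right = φ₁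

  φ-hom : ∀ s → IsMonoidHomomorphism (φ s)
  φ-hom left  = hom₀
  φ-hom right = hom₁

  module Hom (s : Side) = IsMonoidHomomorphism (φ-hom s)

  _○_ : Carrier → Carrier → Carrier
  x ○ y = φ₀ x ∙ φ₁ y

  IsIdentity : Side → Set (c ⊔ ℓ)
  IsIdentity s = ∀ a → φ s a ≈ a

  eval : Path → Carrier → Carrier
  eval []      a = a
  eval (s ∷ w) a = φ s (eval w a)

  SameEval : Path → Path → Set (c ⊔ ℓ)
  SameEval w w' = ∀ a → eval w a ≈ eval w' a

  eval-ε : ∀ w → eval w ε ≈ ε
  eval-ε []      = ≈-refl
  eval-ε (s ∷ w) = ≈-trans (Hom.⟦⟧-cong s (eval-ε w)) (Hom.ε-homo s)

  linForm : List Path → List Carrier → Carrier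
  linForm (w ∷ ws) (x ∷ xs) = eval w x ∙ linForm ws xs
  linForm _        _        = ε

  φ-linForm : ∀ s ws xs → φ s (linForm ws xs) ≈ linForm (map (s ∷_) ws) xs
  φ-linForm s []       xs       = Hom.ε-homo s
  φ-linForm s (w ∷ ws) []       = Hom.ε-homo s
  φ-linForm s (w ∷ ws) (x ∷ xs) = ≈-trans (Hom.homo s _ _) (∙-cong ≈-refl (φ-linForm s ws xs))

  linForm-++ : ∀ ws xs vs ys → length ws ≡ length xs →
               linForm (ws ++ vs) (xs ++ ys) ≈ linForm ws xs ∙ linForm vs ys
  linForm-++ []       []       vs ys _ = ≈-sym (identityˡ _)
  linForm-++ (w ∷ ws) (x ∷ xs) vs ys e = begin
    eval w x ∙ linForm (ws ++ vs) (xs ++ ys)     ≈⟨ ∙-cong ≈-refl (linForm-++ ws xs vs ys (suc-injective e)) ⟩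
    eval w x ∙ (linForm ws xs ∙ linForm vs ys)   ≈⟨ ≈-sym (assoc _ _ _) ⟩
    (eval w x ∙ linForm ws xs) ∙ linForm vs ys   ∎

  termOp-linear : ∀ {n} (t : Bracketing n) xs → termOp _○_ t xs ≈ linForm (paths t) (toList xs)
  termOp-linear leaf (x ∷ []) = ≈-sym (identityʳ x)
  termOp-linear (node {m} {k} l r) xs = begin
    φ₀ (termOp _○_ l xsₗ) ∙ φ₁ (termOp _○_ r xsᵣ)
      ≈⟨ ∙-cong (Hom.⟦⟧-cong left (termOp-linear l xsₗ)) (Hom.⟦⟧-cong right (termOp-linear r xsᵣ)) ⟩
    φ₀ (linForm (paths l) (toList xsₗ)) ∙ φ₁ (linForm (paths r) (toList xsᵣ))
      ≈⟨ ∙-cong (φ-linForm left (paths l) _) (φ-linForm right (paths r) _) ⟩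
    linForm (map (left ∷_) (paths l)) (toList xsₗ) ∙ linForm (map (right ∷_) (paths r)) (toList xsᵣ)
      ≈⟨ ≈-sym (linForm-++ (map (left ∷_) (paths l)) (toList xsₗ) (map (right ∷_) (paths r)) (toList xsᵣ) lengths-agree) ⟩
    linForm (paths (node l r)) (toList xsₗ ++ toList xsᵣ)
      ≡⟨ cong (linForm (paths (node l r))) (trans (sym (toList-++ xsₗ xsᵣ)) (cong toList (take++drop≡id (suc m) xs))) ⟩
    linForm (paths (node l r)) (toList xs) ∎
    where
    xsₗ : Vec Carrier (suc m)
    xsₗ = take (suc m) xs
    xsᵣ : Vec Carrier (suc k)
    xsᵣ = drop (suc m) xs
    lengths-agree : length (map (left ∷_) (paths l)) ≡ length (toList xsₗ)
    lengths-agree = trans (length-map _ (paths l)) (trans (length-paths l) (sym (length-toList xsₗ)))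

  linForm-zeros : ∀ ws n → linForm ws (toList (replicate n ε)) ≈ ε
  linForm-zeros []       n       = ≈-refl
  linForm-zeros (w ∷ ws) zero    = ≈-refl
  linForm-zeros (w ∷ ws) (suc n) = ≈-trans (∙-cong (eval-ε w) (linForm-zeros ws n)) (identityˡ ε)

  linForm-unit : ∀ w ws n a → linForm (w ∷ ws) (toList (a ∷ replicate n ε)) ≈ eval w a
  linForm-unit w ws n a = ≈-trans (∙-cong ≈-refl (linForm-zeros ws n)) (identityʳ _)

  linForm-zeroHead : ∀ w ws {n} (xs : Vec Carrier n) → linForm (w ∷ ws) (toList (ε ∷ xs)) ≈ linForm ws (toList xs)
  linForm-zeroHead w ws xs = ≈-trans (∙-cong (eval-ε w) ≈-refl) (identityˡ _)

  linForm-injective : ∀ {n} ws ws' → length ws ≡ n → length ws' ≡ n →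
    (∀ (xs : Vec Carrier n) → linForm ws (toList xs) ≈ linForm ws' (toList xs)) →
    Pointwise SameEval ws ws'
  linForm-injective []       []         _    _  _    = []
  linForm-injective (w ∷ ws) (w' ∷ ws') refl e' same =
    (λ a → ≈-trans (≈-sym (linForm-unit w ws (length ws) a))
             (≈-trans (same (a ∷ replicate _ ε)) (linForm-unit w' ws' (length ws) a)))
    ∷ linForm-injective ws ws' refl (suc-injective e')
        (λ xs → ≈-trans (≈-sym (linForm-zeroHead w ws xs))
                  (≈-trans (same (ε ∷ xs)) (linForm-zeroHead w' ws' xs)))
  linForm-injective []       (_ ∷ _) refl () _
  linForm-injective (_ ∷ _)  []      refl () _

  sameOp⇒sameEval : ∀ {n} (t u : Bracketing n) → SameOp _≈_ _○_ t u → Pointwise SameEval (paths t) (paths u)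
  sameOp⇒sameEval t u same = linForm-injective (paths t) (paths u) (length-paths t) (length-paths u)
    λ xs → ≈-trans (≈-sym (termOp-linear t xs)) (≈-trans (same xs) (termOp-linear u xs))

  module _ (φ-identity : ∀ s → IsIdentity s) where

    eval-trivial : ∀ w a → eval w a ≈ a
    eval-trivial []      a = ≈-refl
    eval-trivial (s ∷ w) a = ≈-trans (φ-identity s (eval w a)) (eval-trivial w a)

    linForm-trivial : ∀ ws xs → length ws ≡ length xs → linForm ws xs ≈ foldr _∙_ ε xs
    linForm-trivial []       []       _ = ≈-refl
    linForm-trivial (w ∷ ws) (x ∷ xs) e = ∙-cong (eval-trivial w x) (linForm-trivial ws xs (suc-injective e))

    termOp-trivial : ∀ {n} (t : Bracketing n) xs → termOp _○_ t xs ≈ foldr _∙_ ε (toList xs)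
    termOp-trivial t xs = ≈-trans (termOp-linear t xs)
      (linForm-trivial (paths t) (toList xs) (trans (length-paths t) (sym (length-toList xs))))

    spectrum-one : ∀ n → SpecIsOne _≈_ _○_ n
    spectrum-one n t u xs = ≈-trans (termOp-trivial t xs) (≈-sym (termOp-trivial u xs))

  module Separation (injective₀ : Injective _≈_ _≈_ φ₀) (injective₁ : Injective _≈_ _≈_ φ₁) where

    φ-injective : ∀ s → Injective _≈_ _≈_ (φ s)
    φ-injective left  = injective₀
    φ-injective right = injective₁

    eval-injective : ∀ w {a b} → eval w a ≈ eval w b → a ≈ b
    eval-injective []      e = e
    eval-injective (s ∷ w) e = eval-injective w (φ-injective s e)

    eval-∷ʳ : ∀ w s a → eval (w ∷ʳ s) a ≡ eval w (φ s a)
    eval-∷ʳ []      s a = refl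
    eval-∷ʳ (t ∷ w) s a = cong (φ t) (eval-∷ʳ w s a)

    extends-sound : ∀ {c x y} → SameEval x y → Extends c x y → IsIdentity c
    extends-sound {c} same (extends b p) a = eval-injective (b ∷ p) (begin
      eval (b ∷ p) (φ c a)  ≡⟨ sym (eval-∷ʳ (b ∷ p) c a) ⟩
      eval (b ∷ p ∷ʳ c) a   ≈⟨ same a ⟩
      eval (b ∷ p) a        ∎)

    differ-sound : ∀ {c x y} → SameEval x y → Differ c x y → IsIdentity c
    differ-sound same (inj₁ x⊐y) = extends-sound same x⊐y
    differ-sound same (inj₂ y⊐x) = extends-sound (λ a → ≈-sym (same a)) y⊐x

    sameOp-mirror⇒sameEval : ∀ {n} (t u : Bracketing n) → SameOp _≈_ _○_ (mirror t) (mirror u) →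
      Pointwise (λ x y → SameEval (mirrorPath x) (mirrorPath y)) (paths t) (paths u)
    sameOp-mirror⇒sameEval t u same = map⁻ mirrorPath mirrorPath (pointwise-reverse⁻
      (subst₂ (Pointwise SameEval) (paths-mirror t) (paths-mirror u) (sameOp⇒sameEval (mirror t) (mirror u) same)))

    chainFamily-separates : ∀ s {n} {bs bs' : Vec (Fin 2) n} → bs ≢ bs' →
      SameOp _≈_ _○_ (chainFamily s bs) (chainFamily s bs') → IsIdentity s
    chainFamily-separates left {bs = bs} {bs'} bs≢bs' same
      with pointwise-somewhere (sameOp⇒sameEval (rightCombChain bs) (rightCombChain bs') same) (rightCombChain-separated bs≢bs')
    ... | _ , _ , x≈y , x≠y = differ-sound x≈y x≠y
    chainFamily-separates right {bs = bs} {bs'} bs≢bs' same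
      with pointwise-somewhere (sameOp-mirror⇒sameEval (rightCombChain bs) (rightCombChain bs') same) (rightCombChain-separated bs≢bs')
    ... | _ , _ , x≈y , x≠y = differ-sound x≈y (differ-map extends-mirror x≠y)

    spectrum-large : ∀ s → ¬ IsIdentity s → ∀ n → SpecAtLeast _≈_ _○_ (suc n) (2 ^ (suc n ∸ 2))
    spectrum-large s nontrivial zero    = (λ _ → leaf) , λ { zero zero 0≢0 → ⊥-elim (0≢0 refl) }
    spectrum-large s nontrivial (suc n) =
      specAtLeast-digits _≈_ _○_ n (chainFamily s) λ bs≢bs' same → nontrivial (chainFamily-separates s bs≢bs' same)

corollary6p6 : ∀ {c ℓ} (G : Group c ℓ) (φ₀ φ₁ : Group.Carrier G → Group.Carrier G) →
    IsAutomorphism G φ₀ → IsAutomorphism G φ₁ →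
    ¬ ¬ ((∀ n → SpecAtLeast (Group._≈_ G) (linOp G φ₀ φ₁) (suc n) (2 ^ (suc n ∸ 2)))
         ⊎ (∀ n → SpecIsOne (Group._≈_ G) (linOp G φ₀ φ₁) (suc n)))
corollary6p6 G φ₀ φ₁ aut₀ aut₁ ¬dichotomy =
  ¬dichotomy (inj₁ (spectrum-large left λ φ₀-identity →
    ¬dichotomy (inj₁ (spectrum-large right λ φ₁-identity →
      ¬dichotomy (inj₂ (λ n → spectrum-one (λ { left → φ₀-identity ; right → φ₁-identity }) (suc n)))))))
  where
  module A₀ = GroupMorphisms.IsGroupIsomorphism aut₀
  module A₁ = GroupMorphisms.IsGroupIsomorphism aut₁
  open LinearTermOperations (Group.monoid G) φ₀ φ₁ A₀.isMonoidHomomorphism A₁.isMonoidHomomorphism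
  open Separation A₀.injective A₁.injective
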